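{- Let $K$ be a field, $F$ a tract, and $\varphi:K\to F$ an epic homomorphism of tracts. Then for every $m\times n$ matrix $A$ over $F$, $r_{\mathrm{mat}}(\varphi^{ -1}(A)) = r_{\varphi\text{ - }\mathrm{mat}}(A)$; that is, the minimum rank of a matrix $A'$ over $K$ with $\varphi(A')=A$ equals the minimal rank of a $K$-matroid $M$ on $[n]$ such that every row of $A$ is a covector of $\varphi_*(M)$.
   Context: A tract is a multiplicatively written commutative monoid $F$ with an absorbing element $0$ such that $F^\times = F\setminus\{0\}$ is a group, together with a subset $N_F$ (the null set) of the group semiring $\mathbb{N}[F^\times]$, such that: the zero element of $\mathbb{N}[F^\times]$ lies in $N_F$; there is a unique $\epsilon\in F^\times$ with $1+\epsilon\in N_F$; and $N_F$ is closed under multiplication by $F^\times$. Formal sums with zero terms are read with zero terms discarded. A field $K$ is a tract with $N_K$ the formal sums whose sum in $K$ is $0$. A homomorphism of tracts $\varphi:F'\to F$ satisfies $\varphi(0)=0$, restricts to a group homomorphism $(F')^\times\to F^\times$, and $\varphi(N_{F'})\subseteq N_F$; it acts on vectors and matrices entrywise. $X,Y\in F^n$ are orthogonal if $\sum_iX_iY_i\in N_F$. An $F$-matroid $M$ of rank $r$ on $[n]$ is a matroid $\underline{M}$ of rank $r$ on $[n]$ with subsets $\mathcal{C}(M),\mathcal{C}^*(M)\subseteq F^n$ ($F$-circuits, $F$-cocircuits) such that: both are closed under multiplication by $F^\times$; supports of $F$-circuits (resp. $F$-cocircuits) are circuits (resp. cocircuits) of $\underline{M}$; each circuit (resp. cocircuit)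 of $\underline{M}$ is the support of an $F$-circuit (resp. $F$-cocircuit), unique up to $F^\times$-scaling; and every $F$-circuit is orthogonal to every $F$-cocircuit. The vectors of $M$ are the $X\in F^n$ orthogonal to all $F$-cocircuits; the covectors are the $X\in F^n$ orthogonal to all $F$-circuits. (For $F=K$ a field, a $K$-matroid of rank $r$ is the same as an $r$-dimensional subspace of $K^n$, its covectors being the elements of that subspace.) The push-forward $\varphi_*(M')$ of an $F'$-matroid $M'$ has the same underlying matroid, with $F$-circuits (resp. $F$-cocircuits) the vectors $c\varphi(X)$, $X$ an $F'$-circuit (resp. $F'$-cocircuit) of $M'$, $c\in F^\times$. $\varphi:F'\to F$ is epic if for every $F'$-matroid $M'$ the map $X\mapsto\varphi(X)$ from vectors of $M'$ to vectors of $\varphi_*(M')$ is surjective. The matroidal rank of a matrix over a tract is the minimal rank of a matroid over that tract on $[n]$ having all rows as covectors (for matrices over a field, this is the usual rank). $r_{\varphi\text{ - }\mathrm{mat}}(A)$ is the minimal rank of an $F'$-matroid $M'$ with every row of $A$ a covector of $\varphi_*(M')$; $r_{\mathrm{mat}}(\varphi^{ -1}(A))$ is the minimal matroidal rank of a matrix $A'$ over $F'$ with $\varphi(A')=A$, or $+\infty$ if none exists. -}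

module Defs where

open import Level using (Level; _⊔_) renaming (suc to lsuc; zero to lzero)
open import Data.Nat using (ℕ; _≤_)
open import Data.Fin using (Fin)
open import Data.Fin.Subset using (Subset; _∈_; _∉_; _⊆_; _⊂_; _∪_; _-_; ⁅_⁆; ∁; ∣_∣)
open import Data.List using (List; []; _∷_; foldr; map; allFin)
open import Data.List.Relation.Binary.Permutation.Propositional using (_↭_; refl; prep; swap; trans)
open import Data.Product using (Σ; ∃; ∃-syntax; _×_; _,_; proj₁; proj₂)
open import Relation.Nullary using (¬_)
open import Relation.Binary.PropositionalEquality
  using (_≡_; _≢_; cong; cong₂; sym; module ≡-Reasoning)
  renaming (refl to ≡-refl; trans to ≡-trans)
open import Function.Bundles using (_⇔_; mk⇔)
open import Algebra.Structures using (IsCommutativeMonoid; IsCommutativeRing)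

-- Formal sums in ℕ[F^×] are represented by finite lists of elements
-- of F (a list is a multiset up to permutation); zero terms are
-- discarded (axiom N-0∷).

record Tract : Set₁ where
  field
    Carrier : Set
    0# 1#   : Carrier
    _*_     : Carrier → Carrier → Carrier
    *-isCommutativeMonoid : IsCommutativeMonoid _≡_ _*_ 1#
    zeroˡ   : ∀ x → 0# * x ≡ 0#
    1≢0     : 1# ≢ 0#
    inverse : ∀ x → x ≢ 0# → ∃[ y ] (x * y ≡ 1#)
    N       : List Carrier → Set
    N-↭     : ∀ {xs ys} → xs ↭ ys → N xs → N ys
    N-0∷    : ∀ xs → N (0# ∷ xs) ⇔ N xs
    N-[]    : N []
    ε       : Carrier
    ε≢0     : ε ≢ 0#
    N-1+ε   : N (1# ∷ ε ∷ [])
    ε-unique : ∀ e → e ≢ 0# → N (1# ∷ e ∷ []) → e ≡ ε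
    N-scale : ∀ c xs → c ≢ 0# → N xs → N (map (c *_) xs)

record TractHom (F′ F : Tract) : Set where
  private
    module F′ = Tract F′
    module F  = Tract F
  field
    ⟦_⟧       : F′.Carrier → F.Carrier
    map-0     : ⟦ F′.0# ⟧ ≡ F.0#
    map-*     : ∀ x y → ⟦ x F′.* y ⟧ ≡ ⟦ x ⟧ F.* ⟦ y ⟧
    map-≢0    : ∀ x → x ≢ F′.0# → ⟦ x ⟧ ≢ F.0#
    map-N     : ∀ xs → F′.N xs → F.N (map ⟦_⟧ xs)

record Field : Set₁ where
  infixl 6 _+_
  infixl 7 _*_
  field
    Carrier : Set
    _+_ _*_ : Carrier → Carrier → Carrier
    -_      : Carrier → Carrier
    0# 1#   : Carrier
    isCommutativeRing : IsCommutativeRing _≡_ _+_ _*_ -_ 0# 1#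
    1≢0     : 1# ≢ 0#
    inverse : ∀ x → x ≢ 0# → ∃[ y ] (x * y ≡ 1#)

  open IsCommutativeRing isCommutativeRing public
    using (+-assoc; +-comm; +-identityˡ; +-identityʳ; -‿inverseˡ; -‿inverseʳ;
           distribˡ; zeroˡ; zeroʳ; *-isCommutativeMonoid)

  Σ+ : List Carrier → Carrier
  Σ+ = foldr _+_ 0#

module _ (K : Field) where
  open Field K
  open ≡-Reasoning

  private
    swap+ : ∀ x y z → x + (y + z) ≡ y + (x + z)
    swap+ x y z = begin
      x + (y + z) ≡⟨ sym (+-assoc x y z) ⟩
      (x + y) + z ≡⟨ cong (_+ z) (+-comm x y) ⟩
      (y + x) + z ≡⟨ +-assoc y x z ⟩
      y + (x + z) ∎

    Σ+-↭ : ∀ {xs ys} → xs ↭ ys → Σ+ xs ≡ Σ+ ys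
    Σ+-↭ refl = ≡-refl
    Σ+-↭ (prep x p) = cong (x +_) (Σ+-↭ p)
    Σ+-↭ (swap x y p) = ≡-trans (cong (λ s → x + (y + s)) (Σ+-↭ p)) (swap+ x y _)
    Σ+-↭ (trans p q) = ≡-trans (Σ+-↭ p) (Σ+-↭ q)

    Σ+-scale : ∀ c xs → Σ+ (map (c *_) xs) ≡ c * Σ+ xs
    Σ+-scale c [] = sym (zeroʳ c)
    Σ+-scale c (x ∷ xs) = ≡-trans (cong (c * x +_) (Σ+-scale c xs)) (sym (distribˡ c x (Σ+ xs)))

    -1≢0 : - 1# ≢ 0#
    -1≢0 eq = 1≢0 (begin
      1#          ≡⟨ sym (+-identityʳ 1#) ⟩
      1# + 0#     ≡⟨ cong (1# +_) (sym eq) ⟩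
      1# + - 1#   ≡⟨ -‿inverseʳ 1# ⟩
      0# ∎)

    uniq : ∀ e → 1# + (e + 0#) ≡ 0# → e ≡ - 1#
    uniq e h = begin
      e                  ≡⟨ sym (+-identityˡ e) ⟩
      0# + e             ≡⟨ cong (_+ e) (sym (-‿inverseˡ 1#)) ⟩
      (- 1# + 1#) + e    ≡⟨ +-assoc (- 1#) 1# e ⟩
      - 1# + (1# + e)    ≡⟨ cong (λ s → - 1# + (1# + s)) (sym (+-identityʳ e)) ⟩
      - 1# + (1# + (e + 0#)) ≡⟨ cong (- 1# +_) h ⟩
      - 1# + 0#          ≡⟨ +-identityʳ (- 1#) ⟩
      - 1# ∎

  fieldTract : Tract
  fieldTract = record
    { Carrier = Carrier
    ; 0# = 0#
    ; 1# = 1#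
    ; _*_ = _*_
    ; *-isCommutativeMonoid = *-isCommutativeMonoid
    ; zeroˡ = zeroˡ
    ; 1≢0 = 1≢0
    ; inverse = inverse
    ; N = λ xs → Σ+ xs ≡ 0#
    ; N-↭ = λ p h → ≡-trans (sym (Σ+-↭ p)) h
    ; N-0∷ = λ xs → mk⇔ (λ h → ≡-trans (sym (+-identityˡ (Σ+ xs))) h)
                        (λ h → ≡-trans (+-identityˡ (Σ+ xs)) h)
    ; N-[] = ≡-refl
    ; ε = - 1#
    ; ε≢0 = -1≢0
    ; N-1+ε = ≡-trans (cong (1# +_) (+-identityʳ (- 1#))) (-‿inverseʳ 1#)
    ; ε-unique = λ e _ h → uniq e h
    ; N-scale = λ c xs _ h → ≡-trans (Σ+-scale c xs) (≡-trans (cong (c *_) h) (zeroʳ c))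
    }

record Matroid (n r : ℕ) : Set₁ where
  field
    IsBasis        : Subset n → Set
    basis-exists   : ∃[ B ] IsBasis B
    basis-exchange : ∀ B₁ B₂ → IsBasis B₁ → IsBasis B₂ →
                     ∀ x → x ∈ B₁ → x ∉ B₂ →
                     ∃[ y ] (y ∈ B₂ × y ∉ B₁ × IsBasis ((B₁ - x) ∪ ⁅ y ⁆))
    rank           : ∀ B → IsBasis B → ∣ B ∣ ≡ r

module _ {n : ℕ} (IsBasis : Subset n → Set) where
  Independent : Subset n → Set
  Independent I = ∃[ B ] (IsBasis B × I ⊆ B)

  IsCircuitOf : Subset n → Set
  IsCircuitOf C = ¬ Independent C × (∀ D → D ⊂ C → Independent D)

module _ {n r : ℕ} (M : Matroid n r) where
  open Matroid M

  IsCircuit : Subset n → Set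
  IsCircuit = IsCircuitOf IsBasis

  -- cocircuits: circuits of the dual matroid, whose bases are the
  -- complements of bases of M
  IsCocircuit : Subset n → Set
  IsCocircuit = IsCircuitOf (λ B → IsBasis (∁ B))

module _ (F : Tract) where
  open Tract F

  Vector : ℕ → Set
  Vector n = Fin n → Carrier

  Supp : ∀ {n} → Vector n → Subset n → Set
  Supp X C = ∀ i → (i ∈ C ⇔ X i ≢ 0#)

  _·_ : ∀ {n} → Carrier → Vector n → Vector n
  (c · X) i = c * X i

  Orth : ∀ {n} → Vector n → Vector n → Set
  Orth {n} X Y = N (map (λ i → X i * Y i) (allFin n))

  record FMatroid (n r : ℕ) : Set₁ where
    field
      underlying : Matroid n r
      Circ   : Vector n → Set
      Cocirc : Vector n → Set
      Circ-scale   : ∀ c X → c ≢ 0# → Circ X → Circ (c · X)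
      Cocirc-scale : ∀ c X → c ≢ 0# → Cocirc X → Cocirc (c · X)
      Circ-supp    : ∀ X → Circ X → ∃[ C ] (IsCircuit underlying C × Supp X C)
      Cocirc-supp  : ∀ X → Cocirc X → ∃[ C ] (IsCocircuit underlying C × Supp X C)
      Circ-exists   : ∀ C → IsCircuit underlying C → ∃[ X ] (Circ X × Supp X C)
      Cocirc-exists : ∀ C → IsCocircuit underlying C → ∃[ X ] (Cocirc X × Supp X C)
      Circ-unique   : ∀ C X Y → Circ X → Circ Y → Supp X C → Supp Y C →
                      ∃[ c ] (c ≢ 0# × (∀ i → Y i ≡ c * X i))
      Cocirc-unique : ∀ C X Y → Cocirc X → Cocirc Y → Supp X C → Supp Y C →
                      ∃[ c ] (c ≢ 0# × (∀ i → Y i ≡ c * X i))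
      orthogonal    : ∀ X Y → Circ X → Cocirc Y → Orth X Y

    IsVector : Vector n → Set
    IsVector X = ∀ Y → Cocirc Y → Orth X Y

    IsCovector : Vector n → Set
    IsCovector X = ∀ Y → Circ Y → Orth X Y

  Matrix : ℕ → ℕ → Set
  Matrix m n = Fin m → Fin n → Carrier

-- Push-forward along a homomorphism (only its circuits / cocircuits,
-- vectors and covectors are needed)

module _ {F′ F : Tract} (φ : TractHom F′ F) where
  private
    module F′ = Tract F′
    module F  = Tract F
  open TractHom φ

  φ-vec : ∀ {n} → Vector F′ n → Vector F n
  φ-vec X i = ⟦ X i ⟧

  module _ {n r : ℕ} (M′ : FMatroid F′ n r) where
    private module M′ = FMatroid M′

    PushCirc : Vector F n → Set
    PushCirc Y = ∃[ c ] ∃[ X ] (c ≢ F.0# × M′.Circ X × (∀ i → Y i ≡ c F.* ⟦ X i ⟧))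

    PushCocirc : Vector F n → Set
    PushCocirc Y = ∃[ c ] ∃[ X ] (c ≢ F.0# × M′.Cocirc X × (∀ i → Y i ≡ c F.* ⟦ X i ⟧))

    IsPushVector : Vector F n → Set
    IsPushVector X = ∀ Y → PushCocirc Y → Orth F X Y

    IsPushCovector : Vector F n → Set
    IsPushCovector X = ∀ Y → PushCirc Y → Orth F X Y

  Epic : Set₁
  Epic = ∀ n r (M′ : FMatroid F′ n r) (X : Vector F n) →
         IsPushVector M′ X →
         ∃[ X′ ] (FMatroid.IsVector M′ X′ × (∀ i → ⟦ X′ i ⟧ ≡ X i))

IsMinimum : ∀ {ℓ} → (ℕ → Set ℓ) → ℕ → Set ℓ
IsMinimum P r = P r × (∀ s → P s → r ≤ s)

-- some F-matroid of rank s on [n] has all rows of A as covectors;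
-- the matroidal rank of A is the minimum of such s
RowsAreCovectorsOfRank : (F : Tract) → ∀ {m n} → Matrix F m n → ℕ → Set₁
RowsAreCovectorsOfRank F {m} {n} A s =
  ∃[ M ] (∀ i → FMatroid.IsCovector {F} {n} {s} M (A i))

module _ {F′ F : Tract} (φ : TractHom F′ F) where
  open TractHom φ

  -- s = matroidal rank of some A′ over F′ with φ(A′) = A;
  -- r_mat(φ⁻¹(A)) is the minimum of such s (+∞ if there is none)
  PreimageRankCandidate : ∀ {m n} → Matrix F m n → ℕ → Set₁
  PreimageRankCandidate {m} {n} A s =
    ∃[ A′ ] ((∀ i j → ⟦ A′ i j ⟧ ≡ A i j) × RowsAreCovectorsOfRank F′ A′ s)

  -- s = rank of some F′-matroid M′ with every row of A a covector of φ_*(M′);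
  -- r_{φ-mat}(A) is the minimum of such s
  φMatRankCandidate : ∀ {m n} → Matrix F m n → ℕ → Set₁
  φMatRankCandidate {m} {n} A s =
    ∃[ M′ ] (∀ i → IsPushCovector φ {n} {s} M′ (A i))

-- Covectors of an F′-matroid are the vectors of its dual, and push-forward
-- commutes with this swap of circuits and cocircuits. So a matroid realising
-- the rows of A after push-forward is turned, by epicness applied to its dual,
-- into a lift A′ of A whose rows are covectors of the matroid itself; the
-- converse holds for any homomorphism, since it preserves null sums. The two
-- sets of candidate ranks therefore coincide, and so do their minima.
-- The only real work is that complements of bases again satisfy basis
-- exchange, which reduces to a reverse form of basis exchange in M.
module Submission where

open import Defs
open import Data.Nat using (ℕ; _∸_; _<_)
open import Data.Nat.Properties using (<-irrefl)
open import Data.Nat.Induction using (<-wellFounded)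
open import Induction.WellFounded using (Acc; acc)
open import Data.Fin using (Fin; zero; suc; _≟_)
open import Data.Fin.Properties using (any?)
open import Data.Fin.Subset using (Subset; inside; outside; _∈_; _∉_; _⊆_; _⊂_; _∪_; _─_; _-_; ⁅_⁆; ∁; ∣_∣)
open import Data.Fin.Subset.Properties
  using (_∈?_; ⊆-antisym; p⊂q⇒∣p∣<∣q∣; x∈⁅x⁆; x∈⁅y⁆⇒x≡y; x∈p∪q⁻; x∈p∪q⁺;
         p─q⊆p; x∈p∧x∉q⇒x∈p─q; x∈p∧x≢y⇒x∈p-y;
         x∈∁p⇒x∉p; x∉∁p⇒x∈p; x∉p⇒x∈∁p; x∈p⇒x∉∁p; ∣∁p∣≡n∸∣p∣)
open import Data.Vec.Base using (_∷_; there)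
open import Data.List using (map; allFin)
open import Data.List.Properties using (map-∘; map-cong)
open import Data.Product using (∃-syntax; _×_; _,_; proj₁; proj₂)
open import Data.Sum using (_⊎_; inj₁; inj₂)
import Data.Sum as Sum
open import Relation.Nullary using (yes; no; contradiction)
open import Data.Empty using (⊥)
open import Relation.Nullary.Decidable using (_×-dec_; ¬?; decidable-stable)
open import Relation.Binary.PropositionalEquality
  using (_≡_; _≢_; refl; sym; trans; cong; cong₂; subst; module ≡-Reasoning)
open import Function using (_∘_)
open import Function.Bundles using (_⇔_; mk⇔; Equivalence)
open import Function.Properties.Equivalence using () renaming (sym to ⇔-sym)
open import Level using (0ℓ)
open import Algebra.Bundles using (CommutativeMonoid)
open import Algebra.Structures using (IsCommutativeMonoid)
import Algebra.Properties.CommutativeSemigroup as CommSemigroupProperties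

private variable n : ℕ

x∈p─q⇒x∉q : ∀ {x : Fin n} (p q : Subset n) → x ∈ p ─ q → x ∉ q
x∈p─q⇒x∉q {x = zero}  (_ ∷ p) (inside  ∷ q) ()
x∈p─q⇒x∉q {x = zero}  (_ ∷ p) (outside ∷ q) _ ()
x∈p─q⇒x∉q {x = suc x} (_ ∷ p) (_ ∷ q) (there x∈p─q) (there x∈q) = x∈p─q⇒x∉q p q x∈p─q x∈q

x∈p-y⇒x≢y : ∀ {x y : Fin n} (p : Subset n) → x ∈ p - y → x ≢ y
x∈p-y⇒x≢y {y = y} p x∈p-y refl = x∈p─q⇒x∉q p ⁅ y ⁆ x∈p-y (x∈⁅x⁆ y)

∁-involutive : (p : Subset n) → ∁ (∁ p) ≡ p
∁-involutive p = ⊆-antisym (x∉∁p⇒x∈p ∘ x∈∁p⇒x∉p) (x∉p⇒x∈∁p ∘ x∈p⇒x∉∁p)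

⊆∧∣≡∣⇒≡ : ∀ {p q : Subset n} → p ⊆ q → ∣ p ∣ ≡ ∣ q ∣ → p ≡ q
⊆∧∣≡∣⇒≡ {p = p} {q} p⊆q ∣p∣≡∣q∣ = ⊆-antisym p⊆q q⊆p
  where
  q⊆p : q ⊆ p
  q⊆p {i} i∈q = decidable-stable (i ∈? p) λ i∉p →
    <-irrefl ∣p∣≡∣q∣ (p⊂q⇒∣p∣<∣q∣ (p⊆q , i , i∈q , i∉p))

∈-exchange⁻ : ∀ {x y z : Fin n} (p : Subset n) →
              x ∈ (p - y) ∪ ⁅ z ⁆ → (x ∈ p × x ≢ y) ⊎ x ≡ z
∈-exchange⁻ {y = y} {z} p x∈ =
  Sum.map (λ x∈p-y → p─q⊆p p ⁅ y ⁆ x∈p-y , x∈p-y⇒x≢y p x∈p-y) (x∈⁅y⁆⇒x≡y z)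
          (x∈p∪q⁻ (p - y) ⁅ z ⁆ x∈)

∈-exchange⁺ : ∀ {x y z : Fin n} {p : Subset n} →
              (x ∈ p × x ≢ y) ⊎ x ≡ z → x ∈ (p - y) ∪ ⁅ z ⁆
∈-exchange⁺ (inj₁ (x∈p , x≢y))  = x∈p∪q⁺ (inj₁ (x∈p∧x≢y⇒x∈p-y x∈p x≢y))
∈-exchange⁺ {z = z} (inj₂ refl) = x∈p∪q⁺ (inj₂ (x∈⁅x⁆ z))

exchange-involutive : ∀ {x y : Fin n} {p : Subset n} → x ∈ p → y ∉ p →
                      (((p - x) ∪ ⁅ y ⁆) - y) ∪ ⁅ x ⁆ ≡ p
exchange-involutive {x = x} {y} {p} x∈p y∉p = ⊆-antisym ⊆p p⊆
  where
  ⊆p : (((p - x) ∪ ⁅ y ⁆) - y) ∪ ⁅ x ⁆ ⊆ p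
  ⊆p i∈ with ∈-exchange⁻ ((p - x) ∪ ⁅ y ⁆) i∈
  ... | inj₂ refl = x∈p
  ... | inj₁ (i∈ , i≢y) with ∈-exchange⁻ p i∈
  ...   | inj₁ (i∈p , _) = i∈p
  ...   | inj₂ i≡y       = contradiction i≡y i≢y
  p⊆ : p ⊆ (((p - x) ∪ ⁅ y ⁆) - y) ∪ ⁅ x ⁆
  p⊆ {i} i∈p with i ≟ x
  ... | yes i≡x = ∈-exchange⁺ (inj₂ i≡x)
  ... | no  i≢x = ∈-exchange⁺ (inj₁ (∈-exchange⁺ (inj₁ (i∈p , i≢x)) ,
                                    λ { refl → y∉p i∈p }))

∁-exchange : ∀ {x y : Fin n} {p : Subset n} → x ∈ p → y ∉ p →
             (∁ p - y) ∪ ⁅ x ⁆ ≡ ∁ ((p - x) ∪ ⁅ y ⁆)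
∁-exchange {x = x} {y} {p} x∈p y∉p = ⊆-antisym ⊆∁ ∁⊆
  where
  ⊆∁ : (∁ p - y) ∪ ⁅ x ⁆ ⊆ ∁ ((p - x) ∪ ⁅ y ⁆)
  ⊆∁ i∈ = x∉p⇒x∈∁p (λ i∈′ → case (∈-exchange⁻ (∁ p) i∈) (∈-exchange⁻ p i∈′))
    where
    case : ∀ {i} → (i ∈ ∁ p × i ≢ y) ⊎ i ≡ x → (i ∈ p × i ≢ x) ⊎ i ≡ y → ⊥
    case (inj₁ (i∈∁p , _)) (inj₁ (i∈p , _)) = x∈∁p⇒x∉p i∈∁p i∈p
    case (inj₁ (_ , i≢y))  (inj₂ i≡y)       = i≢y i≡y
    case (inj₂ i≡x)        (inj₁ (_ , i≢x)) = i≢x i≡x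
    case (inj₂ refl)       (inj₂ refl)      = y∉p x∈p
  ∁⊆ : ∁ ((p - x) ∪ ⁅ y ⁆) ⊆ (∁ p - y) ∪ ⁅ x ⁆
  ∁⊆ {i} i∈ with i ≟ x
  ... | yes i≡x = ∈-exchange⁺ (inj₂ i≡x)
  ... | no  i≢x = ∈-exchange⁺ (inj₁
          ( x∉p⇒x∈∁p (λ i∈p → x∈∁p⇒x∉p i∈ (∈-exchange⁺ (inj₁ (i∈p , i≢x))))
          , λ i≡y → x∈∁p⇒x∉p i∈ (∈-exchange⁺ (inj₂ i≡y))))

exchange-─⊂ : ∀ {z w : Fin n} {p q : Subset n} → z ∈ q → z ∉ p → w ∈ p →
              ((q - z) ∪ ⁅ w ⁆) ─ p ⊂ q ─ p
exchange-─⊂ {z = z} {w} {p} {q} z∈q z∉p w∈p =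
  ⊆ , z , x∈p∧x∉q⇒x∈p─q z∈q z∉p , z∉
  where
  ⊆ : ((q - z) ∪ ⁅ w ⁆) ─ p ⊆ q ─ p
  ⊆ i∈ with ∈-exchange⁻ q (p─q⊆p _ p i∈)
  ... | inj₁ (i∈q , _) = x∈p∧x∉q⇒x∈p─q i∈q (x∈p─q⇒x∉q _ p i∈)
  ... | inj₂ refl      = contradiction w∈p (x∈p─q⇒x∉q _ p i∈)
  z∉ : z ∉ ((q - z) ∪ ⁅ w ⁆) ─ p
  z∉ z∈ with ∈-exchange⁻ q (p─q⊆p _ p z∈)
  ... | inj₁ (_ , z≢z) = z≢z refl
  ... | inj₂ refl      = z∉p w∈p

module _ {r : ℕ} (M : Matroid n r) where
  open Matroid M

  basis-⊆⇒≡ : ∀ {P Q} → IsBasis P → IsBasis Q → P ⊆ Q → P ≡ Q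
  basis-⊆⇒≡ {P} {Q} bP bQ P⊆Q = ⊆∧∣≡∣⇒≡ P⊆Q (trans (rank P bP) (sym (rank Q bQ)))

  -- Exchanging x out of Q can only bring in elements of P, giving P itself.
  basis-exchange-last : ∀ {P Q x} → IsBasis P → IsBasis Q → x ∈ Q → x ∉ P →
                        (∀ z → z ∈ Q → z ∉ P → z ≡ x) →
                        ∃[ y ] (y ∈ P × y ∉ Q × IsBasis ((P - y) ∪ ⁅ x ⁆))
  basis-exchange-last {P} {Q} {x} bP bQ x∈Q x∉P only-x
    with basis-exchange Q P bQ bP x x∈Q x∉P
  ... | y , y∈P , y∉Q , bQ′ =
    y , y∈P , y∉Q ,
    subst (λ S → IsBasis ((S - y) ∪ ⁅ x ⁆)) (basis-⊆⇒≡ bQ′ bP Q′⊆P)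
          (subst IsBasis (sym (exchange-involutive x∈Q y∉Q)) bQ)
    where
    Q′⊆P : (Q - x) ∪ ⁅ y ⁆ ⊆ P
    Q′⊆P {i} i∈ with ∈-exchange⁻ Q i∈
    ... | inj₁ (i∈Q , i≢x) = decidable-stable (i ∈? P) (i≢x ∘ only-x i i∈Q)
    ... | inj₂ refl        = y∈P

  -- By induction on ∣ Q ─ P ∣: exchanging any other z ∈ Q ─ P moves Q closer to P.
  reverse-basis-exchange : ∀ {P Q x} → IsBasis P → IsBasis Q → x ∈ Q → x ∉ P →
                           ∃[ y ] (y ∈ P × y ∉ Q × IsBasis ((P - y) ∪ ⁅ x ⁆))
  reverse-basis-exchange {P} {Q} bP bQ = go bQ (<-wellFounded ∣ Q ─ P ∣)
    where
    go : ∀ {Q x} → IsBasis Q → Acc _<_ ∣ Q ─ P ∣ → x ∈ Q → x ∉ P →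
         ∃[ y ] (y ∈ P × y ∉ Q × IsBasis ((P - y) ∪ ⁅ x ⁆))
    go {Q} {x} bQ (acc smaller) x∈Q x∉P
      with any? (λ z → z ∈? Q ×-dec ¬? (z ∈? P) ×-dec ¬? (z ≟ x))
    ... | no ∄z = basis-exchange-last bP bQ x∈Q x∉P λ z z∈Q z∉P →
                    decidable-stable (z ≟ x) (λ z≢x → ∄z (z , z∈Q , z∉P , z≢x))
    ... | yes (z , z∈Q , z∉P , z≢x) with basis-exchange Q P bQ bP z z∈Q z∉P
    ...   | w , w∈P , _ , bQ′
      with go bQ′ (smaller (p⊂q⇒∣p∣<∣q∣ (exchange-─⊂ z∈Q z∉P w∈P)))
              (∈-exchange⁺ (inj₁ (x∈Q , z≢x ∘ sym))) x∉P
    ...     | y , y∈P , y∉Q′ , bP′ = y , y∈P , y∉Q , bP′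
      where
      y∉Q : y ∉ Q
      y∉Q y∈Q = y∉Q′ (∈-exchange⁺ (inj₁ (y∈Q , λ { refl → z∉P y∈P })))

  dual : Matroid n (n ∸ r)
  dual = record
    { IsBasis        = IsBasis ∘ ∁
    ; basis-exists   = let B , bB = basis-exists in
                       ∁ B , subst IsBasis (sym (∁-involutive B)) bB
    ; basis-exchange = λ B₁ B₂ b₁ b₂ x x∈B₁ x∉B₂ →
        let y , y∈∁B₁ , y∉∁B₂ , b = reverse-basis-exchange b₁ b₂ (x∉p⇒x∈∁p x∉B₂) (x∈p⇒x∉∁p x∈B₁)
            y∉B₁ = x∈∁p⇒x∉p y∈∁B₁
        in y , x∉∁p⇒x∈p y∉∁B₂ , y∉B₁ , subst IsBasis (∁-exchange x∈B₁ y∉B₁) b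
    ; rank           = λ B bB → begin
        ∣ B ∣         ≡⟨ cong ∣_∣ (sym (∁-involutive B)) ⟩
        ∣ ∁ (∁ B) ∣   ≡⟨ ∣∁p∣≡n∸∣p∣ (∁ B) ⟩
        n ∸ ∣ ∁ B ∣   ≡⟨ cong (n ∸_) (rank (∁ B) bB) ⟩
        n ∸ r         ∎
    }
    where open ≡-Reasoning

IsCircuitOf-cong : ∀ {P Q : Subset n → Set} → (∀ B → P B ⇔ Q B) →
                   ∀ C → IsCircuitOf P C ⇔ IsCircuitOf Q C
IsCircuitOf-cong {n} {P} {Q} P⇔Q C = mk⇔ (transport P⇔Q) (transport (⇔-sym ∘ P⇔Q))
  where
  transport : ∀ {P Q : Subset n → Set} → (∀ B → P B ⇔ Q B) → IsCircuitOf P C → IsCircuitOf Q C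
  transport P⇔Q (dependent , minimal) =
    (λ (B , qB , C⊆B) → dependent (B , Equivalence.from (P⇔Q B) qB , C⊆B)) ,
    (λ D D⊂C → let B , pB , D⊆B = minimal D D⊂C in B , Equivalence.to (P⇔Q B) pB , D⊆B)

IsCocircuit-dual⇔IsCircuit : ∀ {r} (M : Matroid n r) C → IsCocircuit (dual M) C ⇔ IsCircuit M C
IsCocircuit-dual⇔IsCircuit M = IsCircuitOf-cong λ B →
  mk⇔ (subst IsBasis (∁-involutive B)) (subst IsBasis (sym (∁-involutive B)))
  where open Matroid M

Orth-sym : (F : Tract) (X Y : Vector F n) → Orth F X Y → Orth F Y X
Orth-sym {n} F X Y = subst N (map-cong (λ i → comm (X i) (Y i)) (allFin n))
  where
  open Tract F
  open IsCommutativeMonoid *-isCommutativeMonoid using (comm)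

dualᶠ : ∀ {F : Tract} {r} → FMatroid F n r → FMatroid F n (n ∸ r)
dualᶠ {F = F} M = record
  { underlying    = dual underlying
  ; Circ          = Cocirc
  ; Cocirc        = Circ
  ; Circ-scale    = Cocirc-scale
  ; Cocirc-scale  = Circ-scale
  ; Circ-supp     = Cocirc-supp
  ; Cocirc-supp   = λ X cX → let C , isC , supp = Circ-supp X cX in
                               C , Equivalence.from (cocircuit⇔circuit C) isC , supp
  ; Circ-exists   = Cocirc-exists
  ; Cocirc-exists = λ C isC → Circ-exists C (Equivalence.to (cocircuit⇔circuit C) isC)
  ; Circ-unique   = Cocirc-unique
  ; Cocirc-unique = Circ-unique
  ; orthogonal    = λ X Y cX cY → Orth-sym F Y X (orthogonal Y X cY cX)
  }
  where
  open FMatroid M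
  cocircuit⇔circuit : ∀ C → IsCocircuit (dual underlying) C ⇔ IsCircuit underlying C
  cocircuit⇔circuit = IsCocircuit-dual⇔IsCircuit underlying

module _ {F′ F : Tract} (φ : TractHom F′ F) where
  private
    module F′ = Tract F′
    module F  = Tract F
    *-commutativeMonoid : CommutativeMonoid 0ℓ 0ℓ
    *-commutativeMonoid = record { isCommutativeMonoid = F.*-isCommutativeMonoid }
  open TractHom φ
  open CommSemigroupProperties (CommutativeMonoid.commutativeSemigroup *-commutativeMonoid)
    using (x∙yz≈y∙xz)

  IsCovector⇒IsPushCovector : ∀ {r} (M′ : FMatroid F′ n r) {X′ : Vector F′ n} {X : Vector F n} →
                              (∀ j → ⟦ X′ j ⟧ ≡ X j) → FMatroid.IsCovector M′ X′ →
                              IsPushCovector φ M′ X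
  IsCovector⇒IsPushCovector {n} M′ {X′} {X} φX′≡X covX′ Y (c , Z , c≢0 , circZ , Y≡cφZ) =
    subst F.N pushed-sum≡XY (F.N-scale c _ c≢0 (map-N _ (covX′ Z circZ)))
    where
    open ≡-Reasoning
    term : ∀ j → c F.* ⟦ X′ j F′.* Z j ⟧ ≡ X j F.* Y j
    term j = begin
      c F.* ⟦ X′ j F′.* Z j ⟧        ≡⟨ cong (c F.*_) (map-* (X′ j) (Z j)) ⟩
      c F.* (⟦ X′ j ⟧ F.* ⟦ Z j ⟧)   ≡⟨ x∙yz≈y∙xz c ⟦ X′ j ⟧ ⟦ Z j ⟧ ⟩
      ⟦ X′ j ⟧ F.* (c F.* ⟦ Z j ⟧)   ≡⟨ cong₂ F._*_ (φX′≡X j) (sym (Y≡cφZ j)) ⟩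
      X j F.* Y j                    ∎
    pushed-sum≡XY : map (c F.*_) (map ⟦_⟧ (map (λ j → X′ j F′.* Z j) (allFin n)))
                  ≡ map (λ j → X j F.* Y j) (allFin n)
    pushed-sum≡XY = begin
      map (c F.*_) (map ⟦_⟧ (map _ (allFin n)))  ≡⟨ cong (map (c F.*_)) (sym (map-∘ (allFin n))) ⟩
      map (c F.*_) (map _ (allFin n))            ≡⟨ sym (map-∘ (allFin n)) ⟩
      map _ (allFin n)                           ≡⟨ map-cong term (allFin n) ⟩
      map (λ j → X j F.* Y j) (allFin n)         ∎

  PreimageRankCandidate⇒φMatRankCandidate : ∀ {m n} (A : Matrix F m n) s →
    PreimageRankCandidate φ A s → φMatRankCandidate φ A s
  PreimageRankCandidate⇒φMatRankCandidate A s (A′ , φA′≡A , M′ , covA′) =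
    M′ , λ i → IsCovector⇒IsPushCovector M′ (φA′≡A i) (covA′ i)

  -- IsCovector M′ and IsPushCovector φ M′ are definitionally
  -- IsVector (dualᶠ M′) and IsPushVector φ (dualᶠ M′).
  Epic⇒φMatRankCandidate⇒PreimageRankCandidate : Epic φ → ∀ {m n} (A : Matrix F m n) s →
    φMatRankCandidate φ A s → PreimageRankCandidate φ A s
  Epic⇒φMatRankCandidate⇒PreimageRankCandidate epic {n = n} A s (M′ , pushCovA) =
    (λ i → lift-row i .proj₁) , (λ i → lift-row i .proj₂ .proj₂) ,
    M′ , (λ i → lift-row i .proj₂ .proj₁)
    where
    lift-row : ∀ i → ∃[ X′ ] (FMatroid.IsCovector M′ X′ × (∀ j → ⟦ X′ j ⟧ ≡ A i j))
    lift-row i = epic n (n ∸ s) (dualᶠ M′) (A i) (pushCovA i)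

IsMinimum-cong : ∀ {ℓ} {P Q : ℕ → Set ℓ} → (∀ s → P s ⇔ Q s) → ∀ r → IsMinimum P r ⇔ IsMinimum Q r
IsMinimum-cong P⇔Q r =
  mk⇔ (λ (Pr , r≤P) → Equivalence.to (P⇔Q r) Pr , λ s → r≤P s ∘ Equivalence.from (P⇔Q s))
      (λ (Qr , r≤Q) → Equivalence.from (P⇔Q r) Qr , λ s → r≤Q s ∘ Equivalence.to (P⇔Q s))

theorem4p9 : (K : Field) (F : Tract) (φ : TractHom (fieldTract K) F) → Epic φ →
    ∀ {m n} (A : Matrix F m n) (r : ℕ) →
    IsMinimum (PreimageRankCandidate φ A) r ⇔ IsMinimum (φMatRankCandidate φ A) r
theorem4p9 K F φ epic A = IsMinimum-cong λ s →
  mk⇔ (PreimageRankCandidate⇒φMatRankCandidate φ A s)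
      (Epic⇒φMatRankCandidate⇒PreimageRankCandidate φ epic A s)
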